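{- Let $m$ be a positive integer, and let $n=64m+27$ and $m_1=8m+3$ (i.e., in binary, $n$ is the expansion of $m$ followed by $011011$, and $m_1$ is the expansion of $m$ followed by $011$). Then \[ |H_8^{\nabla n}|=47\cdot|H_8^{\nabla m_1}|-40\cdot|H_8^{\nabla m}|. \]
   Context: For nonempty finite sets $C=\{c_1,\ldots,c_s\}$, $D$ of positive integers, $C\mathbin{\nabla}D=c_1D\mathbin{\triangle}\cdots\mathbin{\triangle}c_sD$, where $c_iD=\{c_id:d\in D\}$ and $\triangle$ is symmetric difference. Let $H_8=\{1,2,\ldots,8\}$, $H_8^{\nabla0}=\{1\}$ and $H_8^{\nabla k}=H_8^{\nabla(k-1)}\mathbin{\nabla}H_8$ for $k\geq1$. -}

module Defs where

open import Data.Nat using (ℕ; zero; suc; _*_; _<ᵇ_)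
open import Data.Bool using (if_then_else_)
open import Data.List using (List; []; _∷_; map; foldl; length; upTo)

-- Finite sets of positive integers are represented canonically as
-- strictly increasing lists of natural numbers.

symDiff : List ℕ → List ℕ → List ℕ
symDiff [] ys = ys
symDiff (x ∷ xs) [] = x ∷ xs
symDiff (x ∷ xs) (y ∷ ys) =
  if x <ᵇ y then x ∷ symDiff xs (y ∷ ys)
  else if y <ᵇ x then y ∷ symDiff (x ∷ xs) ys
  else symDiff xs ys

scale : ℕ → List ℕ → List ℕ
scale c D = map (c *_) D

-- C ∇ D = c₁D △ c₂D △ ⋯ △ c_sD   (△ is associative/commutative, ∅ is its unit)
nabla : List ℕ → List ℕ → List ℕ
nabla C D = foldl (λ acc c → symDiff acc (scale c D)) [] C

H8 : List ℕ
H8 = map suc (upTo 8)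

H8pow : ℕ → List ℕ
H8pow zero = 1 ∷ []
H8pow (suc k) = nabla (H8pow k) H8

card : ℕ → ℕ
card k = length (H8pow k)

module Submission where

-- Read a finite set of positive integers as an element of the monoid algebra
-- 𝔽₂[(ℕ⁺, ·)]; then C ∇ D is the product C·D and H₈^{∇k} is the power H₈ᵏ.
-- In characteristic 2 squaring is additive, so H₈^{2k} = (H₈ᵏ)² and
-- H₈^{2k+1} = (H₈ᵏ)² H₈.  For K = {1}, {1,2}, {1,4} and ε ∈ {0,1} the product
-- H₈^ε K splits as a sum Σ r·K_r² over distinct squarefree r, hence
-- H₈^{2k+ε} K = Σ r·(H₈ᵏ K_r)².  The summands are disjoint sets, because
-- r s² = r' t² is impossible when some prime divides r exactly once but not r',
-- so the three cardinalities |H₈ᵏ K| obey linear recurrences in the binary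
-- digits of k.  Appending the digits 011 acts on them linearly, and applying
-- this map twice yields the identity.

open import Defs

open import Data.Bool using (Bool; true; false; _xor_)
open import Data.Bool.Properties using (not-involutive)
open import Data.Empty using (⊥)
open import Data.Integer using (+_; _-_; _⊖_)
import Data.Integer.Properties as ℤ
open import Data.List using (List; []; _∷_; _++_; map; foldl; foldr; length)
-- Overloaded list constructors make the ring solver slow to elaborate its list of variables.
open import Data.List using () renaming (_∷_ to _∷ₗ_; [] to []ₗ)
open import Data.List.Properties using (≡-dec; ++-assoc; ++-identityʳ; map-++; map-cong; map-∘; map-id; length-map)
open import Data.List.Membership.Propositional using (_∈_)
open import Data.List.Membership.Propositional.Properties using (∈-map⁻)
open import Data.List.Relation.Unary.All as All using (All; []; _∷_; all?)
import Data.List.Relation.Unary.All.Properties as All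
open import Data.List.Relation.Unary.AllPairs as AllPairs using (AllPairs; []; _∷_; allPairs?)
import Data.List.Relation.Unary.AllPairs.Properties as AllPairs
open import Data.List.Relation.Unary.Any using (here; there; toSum)
open import Data.Nat
  using (ℕ; zero; suc; _+_; _*_; _∸_; _≤_; _<_; _<?_; _≟_; _<ᵇ_; z<s; NonZero; >-nonZero; >-nonZero⁻¹; nonTrivial⇒n>1; anyUpTo?)
open import Data.Nat.Divisibility using (_∣_; divides; _∣?_)
open import Data.Nat.Induction using (<-rec)
open import Data.Nat.ListAction using (sum)
open import Data.Nat.Primality using (Prime; prime?; euclidsLemma; prime⇒nonZero; prime⇒nonTrivial)
open import Data.Nat.Properties
open import Data.Nat.Tactic.RingSolver using (solve; solve-∀)
open import Data.Product using (_×_; _,_; proj₁; proj₂; ∃)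
open import Data.Sum as Sum using (_⊎_; inj₁; inj₂)
open import Function using (_∘_)
open import Level using (0ℓ)
open import Relation.Binary.Bundles using (Setoid)
open import Relation.Binary.Definitions using (tri<; tri≈; tri>)
open import Relation.Binary.PropositionalEquality
  using (_≡_; _≢_; refl; sym; trans; cong; cong₂; subst; module ≡-Reasoning)
import Relation.Binary.Reasoning.Setoid as SetoidReasoning
open import Relation.Nullary using (¬_; Dec; does; ¬?; contradiction)
open import Relation.Nullary.Decidable using (dec-true; dec-false; True; toWitness; from-yes; _×-dec_; _⊎-dec_)
open import Relation.Nullary.Reflects using (ofʸ; ofⁿ)

-- Equality of formal sums over 𝔽₂

-- xs ~ ys: every number occurs in xs and in ys with the same parity.
infix 4 _~_
data _~_ : List ℕ → List ℕ → Set where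
  ~-refl   : ∀ {xs} → xs ~ xs
  ~-sym    : ∀ {xs ys} → xs ~ ys → ys ~ xs
  ~-trans  : ∀ {xs ys zs} → xs ~ ys → ys ~ zs → xs ~ zs
  ~-prep   : ∀ {x xs ys} → xs ~ ys → x ∷ xs ~ x ∷ ys
  ~-swap   : ∀ {x y xs} → x ∷ y ∷ xs ~ y ∷ x ∷ xs
  ~-cancel : ∀ {x xs} → x ∷ x ∷ xs ~ xs

~-setoid : Setoid 0ℓ 0ℓ
~-setoid = record
  { Carrier = List ℕ ; _≈_ = _~_
  ; isEquivalence = record { refl = ~-refl ; sym = ~-sym ; trans = ~-trans } }

module ~-Reasoning = SetoidReasoning ~-setoid

~-reflexive : ∀ {xs ys} → xs ≡ ys → xs ~ ys
~-reflexive refl = ~-refl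

++⁺ˡ : ∀ ws {xs ys} → xs ~ ys → ws ++ xs ~ ws ++ ys
++⁺ˡ []       p = p
++⁺ˡ (w ∷ ws) p = ~-prep (++⁺ˡ ws p)

++⁺ʳ : ∀ {xs ys} zs → xs ~ ys → xs ++ zs ~ ys ++ zs
++⁺ʳ zs ~-refl        = ~-refl
++⁺ʳ zs (~-sym p)     = ~-sym (++⁺ʳ zs p)
++⁺ʳ zs (~-trans p q) = ~-trans (++⁺ʳ zs p) (++⁺ʳ zs q)
++⁺ʳ zs (~-prep p)    = ~-prep (++⁺ʳ zs p)
++⁺ʳ zs ~-swap        = ~-swap
++⁺ʳ zs ~-cancel      = ~-cancel

++⁺ : ∀ {ws xs ys zs} → ws ~ xs → ys ~ zs → ws ++ ys ~ xs ++ zs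
++⁺ {xs = xs} {ys} p q = ~-trans (++⁺ʳ ys p) (++⁺ˡ xs q)

shift : ∀ xs {y ys} → y ∷ xs ++ ys ~ xs ++ y ∷ ys
shift []       = ~-refl
shift (x ∷ xs) = ~-trans ~-swap (~-prep (shift xs))

++-comm : ∀ xs ys → xs ++ ys ~ ys ++ xs
++-comm []       ys = ~-reflexive (sym (++-identityʳ ys))
++-comm (x ∷ xs) ys = ~-trans (~-prep (++-comm xs ys)) (shift ys)

++-cancel : ∀ xs ys → xs ++ xs ++ ys ~ ys
++-cancel []       ys = ~-refl
++-cancel (x ∷ xs) ys = ~-trans (~-prep (~-sym (shift xs))) (~-trans ~-cancel (++-cancel xs ys))

++-swap : ∀ xs ys zs → xs ++ ys ++ zs ~ ys ++ xs ++ zs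
++-swap xs ys zs = ~-trans (~-reflexive (sym (++-assoc xs ys zs)))
  (~-trans (++⁺ʳ zs (++-comm xs ys)) (~-reflexive (++-assoc ys xs zs)))

map⁺ : ∀ (f : ℕ → ℕ) {xs ys} → xs ~ ys → map f xs ~ map f ys
map⁺ f ~-refl        = ~-refl
map⁺ f (~-sym p)     = ~-sym (map⁺ f p)
map⁺ f (~-trans p q) = ~-trans (map⁺ f p) (map⁺ f q)
map⁺ f (~-prep p)    = ~-prep (map⁺ f p)
map⁺ f ~-swap        = ~-swap
map⁺ f ~-cancel      = ~-cancel

parity : ℕ → List ℕ → Bool
parity z []       = false
parity z (x ∷ xs) = does (z ≟ x) xor parity z xs

xor-leftComm : ∀ a b c → a xor (b xor c) ≡ b xor (a xor c)
xor-leftComm false b     c = refl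
xor-leftComm true  false c = refl
xor-leftComm true  true  c = refl

xor-cancelˡ : ∀ a c → a xor (a xor c) ≡ c
xor-cancelˡ false c = refl
xor-cancelˡ true  c = not-involutive c

xor-injectiveˡ : ∀ a {c d} → a xor c ≡ a xor d → c ≡ d
xor-injectiveˡ a {c} {d} eq = trans (sym (xor-cancelˡ a c)) (trans (cong (a xor_) eq) (xor-cancelˡ a d))

parity-resp-~ : ∀ {xs ys} → xs ~ ys → ∀ z → parity z xs ≡ parity z ys
parity-resp-~ ~-refl                z = refl
parity-resp-~ (~-sym p)             z = sym (parity-resp-~ p z)
parity-resp-~ (~-trans p q)         z = trans (parity-resp-~ p z) (parity-resp-~ q z)
parity-resp-~ (~-prep {x} p)        z = cong (does (z ≟ x) xor_) (parity-resp-~ p z)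
parity-resp-~ (~-swap {x} {y} {xs}) z = xor-leftComm (does (z ≟ x)) (does (z ≟ y)) (parity z xs)
parity-resp-~ (~-cancel {x} {xs})   z = xor-cancelˡ (does (z ≟ x)) (parity z xs)

-- The product of the monoid algebra 𝔽₂[(ℕ, ·)]

infixl 7 _⊗_
_⊗_ : List ℕ → List ℕ → List ℕ
[]      ⊗ D = []
(c ∷ C) ⊗ D = map (c *_) D ++ C ⊗ D

square : ℕ → ℕ
square x = x * x

⊗-congˡ : ∀ {C C'} D → C ~ C' → C ⊗ D ~ C' ⊗ D
⊗-congˡ D ~-refl        = ~-refl
⊗-congˡ D (~-sym p)     = ~-sym (⊗-congˡ D p)
⊗-congˡ D (~-trans p q) = ~-trans (⊗-congˡ D p) (⊗-congˡ D q)
⊗-congˡ D (~-prep {x} p) = ++⁺ˡ (map (x *_) D) (⊗-congˡ D p)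
⊗-congˡ D (~-swap {x} {y} {xs}) = ++-swap (map (x *_) D) (map (y *_) D) (xs ⊗ D)
⊗-congˡ D (~-cancel {x} {xs}) = ++-cancel (map (x *_) D) (xs ⊗ D)

⊗-congʳ : ∀ C {D D'} → D ~ D' → C ⊗ D ~ C ⊗ D'
⊗-congʳ []      p = ~-refl
⊗-congʳ (c ∷ C) p = ++⁺ (map⁺ (c *_) p) (⊗-congʳ C p)

⊗-distribʳ-++ : ∀ C C' D → (C ++ C') ⊗ D ≡ C ⊗ D ++ C' ⊗ D
⊗-distribʳ-++ []      C' D = refl
⊗-distribʳ-++ (c ∷ C) C' D = trans (cong (map (c *_) D ++_) (⊗-distribʳ-++ C C' D))
  (sym (++-assoc (map (c *_) D) (C ⊗ D) (C' ⊗ D)))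

map-*-⊗ : ∀ a C D → map (a *_) C ⊗ D ≡ map (a *_) (C ⊗ D)
map-*-⊗ a []      D = refl
map-*-⊗ a (c ∷ C) D = trans
  (cong₂ _++_ (trans (map-cong (*-assoc a c) D) (map-∘ D)) (map-*-⊗ a C D))
  (sym (map-++ (a *_) (map (c *_) D) (C ⊗ D)))

⊗-assoc : ∀ A B C → A ⊗ B ⊗ C ≡ A ⊗ (B ⊗ C)
⊗-assoc []      B C = refl
⊗-assoc (a ∷ A) B C = trans (⊗-distribʳ-++ (map (a *_) B) (A ⊗ B) C)
  (cong₂ _++_ (map-*-⊗ a B C) (⊗-assoc A B C))

⊗-zeroʳ : ∀ C → C ⊗ [] ≡ []
⊗-zeroʳ []      = refl
⊗-zeroʳ (c ∷ C) = ⊗-zeroʳ C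

⊗-∷ʳ : ∀ C d D → C ⊗ (d ∷ D) ~ map (_* d) C ++ C ⊗ D
⊗-∷ʳ []      d D = ~-refl
⊗-∷ʳ (c ∷ C) d D = ~-prep (~-trans (++⁺ˡ (map (c *_) D) (⊗-∷ʳ C d D))
  (++-swap (map (c *_) D) (map (_* d) C) (C ⊗ D)))

⊗-comm : ∀ C D → C ⊗ D ~ D ⊗ C
⊗-comm C []      = ~-reflexive (⊗-zeroʳ C)
⊗-comm C (d ∷ D) = ~-trans (⊗-∷ʳ C d D)
  (++⁺ (~-reflexive (map-cong (λ c → *-comm c d) C)) (⊗-comm C D))

⊗-identityˡ : ∀ D → (1 ∷ []) ⊗ D ≡ D
⊗-identityˡ D = trans (++-identityʳ _) (trans (map-cong *-identityˡ D) (map-id D))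

⊗-identityʳ : ∀ C → C ⊗ (1 ∷ []) ~ C
⊗-identityʳ C = ~-trans (⊗-comm C (1 ∷ [])) (~-reflexive (⊗-identityˡ C))

-- The cross terms c·d and d·c cancel in pairs.
⊗-self : ∀ C → C ⊗ C ~ map square C
⊗-self []      = ~-refl
⊗-self (c ∷ C) = ~-prep (begin
  map (c *_) C ++ C ⊗ (c ∷ C)               ≈⟨ ++⁺ˡ (map (c *_) C) (⊗-∷ʳ C c C) ⟩
  map (c *_) C ++ map (_* c) C ++ C ⊗ C     ≈⟨ ++⁺ˡ (map (c *_) C) (++⁺ʳ (C ⊗ C) (~-reflexive (map-cong (λ x → *-comm x c) C))) ⟩
  map (c *_) C ++ map (c *_) C ++ C ⊗ C     ≈⟨ ++-cancel (map (c *_) C) (C ⊗ C) ⟩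
  C ⊗ C                                     ≈⟨ ⊗-self C ⟩
  map square C                              ∎)
  where open ~-Reasoning

sq-⊗ : ∀ C D → map square (C ⊗ D) ≡ map square C ⊗ map square D
sq-⊗ []      D = refl
sq-⊗ (c ∷ C) D = trans (map-++ square (map (c *_) D) (C ⊗ D))
  (cong₂ _++_ (trans (sym (map-∘ D)) (trans (map-cong (λ d → [m*n]*[o*p]≡[m*o]*[n*p] c d c d) D) (map-∘ D)))
              (sq-⊗ C D))

symDiff-∷-elim : (P : List ℕ → Set) → ∀ x y xs ys →
  (x < y → P (x ∷ symDiff xs (y ∷ ys))) →
  (y < x → P (y ∷ symDiff (x ∷ xs) ys)) →
  (x ≡ y → P (symDiff xs ys)) →
  P (symDiff (x ∷ xs) (y ∷ ys))
symDiff-∷-elim P x y xs ys lt gt eq with x <ᵇ y | <ᵇ-reflects-< x y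
... | true  | ofʸ x<y = lt x<y
... | false | ofⁿ x≮y with y <ᵇ x | <ᵇ-reflects-< y x
...   | true  | ofʸ y<x = gt y<x
...   | false | ofⁿ y≮x = eq (≤-antisym (≮⇒≥ y≮x) (≮⇒≥ x≮y))

symDiff~++ : ∀ xs ys → symDiff xs ys ~ xs ++ ys
symDiff~++ []       ys       = ~-refl
symDiff~++ (x ∷ xs) []       = ~-reflexive (sym (++-identityʳ _))
symDiff~++ (x ∷ xs) (y ∷ ys) = symDiff-∷-elim (_~ x ∷ xs ++ y ∷ ys) x y xs ys
  (λ _ → ~-prep (symDiff~++ xs (y ∷ ys)))
  (λ _ → ~-trans (~-prep (symDiff~++ (x ∷ xs) ys)) (shift (x ∷ xs)))
  (λ { refl → ~-sym (~-trans (~-prep (~-sym (shift xs))) (~-trans ~-cancel (~-sym (symDiff~++ xs ys)))) })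

nabla~⊗ : ∀ C D → nabla C D ~ C ⊗ D
nabla~⊗ C D = foldl~ [] C
  where
  foldl~ : ∀ acc C → foldl (λ acc c → symDiff acc (scale c D)) acc C ~ acc ++ C ⊗ D
  foldl~ acc []      = ~-reflexive (sym (++-identityʳ acc))
  foldl~ acc (c ∷ C) = ~-trans (foldl~ (symDiff acc (scale c D)) C)
    (~-trans (++⁺ʳ (C ⊗ D) (symDiff~++ acc (scale c D))) (~-reflexive (++-assoc acc (scale c D) (C ⊗ D))))

-- Strictly increasing lists are canonical representatives

Strict : List ℕ → Set
Strict = AllPairs _<_

strict? : ∀ xs → Dec (Strict xs)
strict? = allPairs? _<?_

Positive : List ℕ → Set
Positive = All (0 <_)

All-symDiff : ∀ {P : ℕ → Set} xs ys → All P xs → All P ys → All P (symDiff xs ys)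
All-symDiff []       ys       _  pys = pys
All-symDiff (x ∷ xs) []       pxs _  = pxs
All-symDiff {P} (x ∷ xs) (y ∷ ys) pxs@(px ∷ pxs′) pys@(py ∷ pys′) = symDiff-∷-elim (All P) x y xs ys
  (λ _ → px ∷ All-symDiff xs (y ∷ ys) pxs′ pys)
  (λ _ → py ∷ All-symDiff (x ∷ xs) ys pxs pys′)
  (λ _ → All-symDiff xs ys pxs′ pys′)

<-All : ∀ {x y ys} → x < y → All (y <_) ys → All (x <_) ys
<-All x<y = All.map (<-trans x<y)

symDiff-strict : ∀ xs ys → Strict xs → Strict ys → Strict (symDiff xs ys)
symDiff-strict []       ys       _  sys = sys
symDiff-strict (x ∷ xs) []       sxs _  = sxs
symDiff-strict (x ∷ xs) (y ∷ ys) sxs@(x<xs ∷ sxs′) sys@(y<ys ∷ sys′) = symDiff-∷-elim Strict x y xs ys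
  (λ x<y → All-symDiff xs (y ∷ ys) x<xs (x<y ∷ <-All x<y y<ys) ∷ symDiff-strict xs (y ∷ ys) sxs′ sys)
  (λ y<x → All-symDiff (x ∷ xs) ys (y<x ∷ <-All y<x x<xs) y<ys ∷ symDiff-strict (x ∷ xs) ys sxs sys′)
  (λ _ → symDiff-strict xs ys sxs′ sys′)

scale-strict : ∀ {c} → 0 < c → ∀ {D} → Strict D → Strict (scale c D)
scale-strict {c} 0<c = AllPairs.map⁺ ∘ AllPairs.map (*-monoʳ-< c {{>-nonZero 0<c}})

scale-positive : ∀ {c} → 0 < c → ∀ {D} → Positive D → Positive (scale c D)
scale-positive 0<c = All.map⁺ ∘ All.map (*-mono-< 0<c)

square-strict : ∀ {D} → Strict D → Strict (map square D)
square-strict = AllPairs.map⁺ ∘ AllPairs.map (λ x<y → *-mono-< x<y x<y)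

module _ {D : List ℕ} where
  private
    step : List ℕ → ℕ → List ℕ
    step acc c = symDiff acc (scale c D)

    foldl-strict : Strict D → ∀ {acc} C → Positive C → Strict acc → Strict (foldl step acc C)
    foldl-strict sD []      _          sacc = sacc
    foldl-strict sD (c ∷ C) (0<c ∷ pC) sacc = foldl-strict sD C pC (symDiff-strict _ _ sacc (scale-strict 0<c sD))

    foldl-positive : Positive D → ∀ {acc} C → Positive C → Positive acc → Positive (foldl step acc C)
    foldl-positive pD []      _          pacc = pacc
    foldl-positive pD (c ∷ C) (0<c ∷ pC) pacc = foldl-positive pD C pC (All-symDiff _ _ pacc (scale-positive 0<c pD))

  nabla-strict : ∀ {C} → Positive C → Strict D → Strict (nabla C D)
  nabla-strict {C} pC sD = foldl-strict sD C pC []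

  nabla-positive : ∀ {C} → Positive C → Positive D → Positive (nabla C D)
  nabla-positive {C} pC pD = foldl-positive pD C pC []

parity-below : ∀ {z xs} → All (z <_) xs → parity z xs ≡ false
parity-below []            = refl
parity-below {z} (z<x ∷ z<xs) rewrite dec-false (z ≟ _) (<⇒≢ z<x) | parity-below z<xs = refl

parity-head : ∀ {x xs} → All (x <_) xs → parity x (x ∷ xs) ≡ true
parity-head {x} x<xs rewrite dec-true (x ≟ x) refl | parity-below x<xs = refl

-- The least element of a strict list has parity 1 there and 0 in the other list.
strict-parity-≡ : ∀ {xs ys} → Strict xs → Strict ys → (∀ z → parity z xs ≡ parity z ys) → xs ≡ ys
strict-parity-≡ [] [] _ = refl
strict-parity-≡ [] (_∷_ {y} y<ys _) eq = contradiction (trans (eq y) (parity-head y<ys)) λ ()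
strict-parity-≡ (_∷_ {x} x<xs _) [] eq = contradiction (trans (sym (eq x)) (parity-head x<xs)) λ ()
strict-parity-≡ (_∷_ {x} x<xs sxs) (_∷_ {y} y<ys sys) eq with <-cmp x y
... | tri< x<y _ _ = contradiction
  (trans (sym (parity-head x<xs)) (trans (eq x) (parity-below (x<y ∷ <-All x<y y<ys)))) λ ()
... | tri> _ _ y<x = contradiction
  (trans (sym (parity-head y<ys)) (trans (sym (eq y)) (parity-below (y<x ∷ <-All y<x x<xs)))) λ ()
... | tri≈ _ refl _ = cong (x ∷_) (strict-parity-≡ sxs sys (λ z → xor-injectiveˡ (does (z ≟ x)) (eq z)))

strict-~⇒≡ : ∀ {xs ys} → Strict xs → Strict ys → xs ~ ys → xs ≡ ys
strict-~⇒≡ sxs sys xs~ys = strict-parity-≡ sxs sys (parity-resp-~ xs~ys)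

normalize : List ℕ → List ℕ
normalize = foldr (λ x → symDiff (x ∷ [])) []

normalize~ : ∀ xs → normalize xs ~ xs
normalize~ []       = ~-refl
normalize~ (x ∷ xs) = ~-trans (symDiff~++ (x ∷ []) (normalize xs)) (~-prep (normalize~ xs))

≡-normalize⇒~ : ∀ xs ys → normalize xs ≡ normalize ys → xs ~ ys
≡-normalize⇒~ xs ys eq = ~-trans (~-sym (normalize~ xs)) (~-trans (~-reflexive eq) (normalize~ ys))

∈-symDiff⁻ : ∀ xs ys {z} → z ∈ symDiff xs ys → z ∈ xs ⊎ z ∈ ys
∈-symDiff⁻ []       ys       z∈ = inj₂ z∈
∈-symDiff⁻ (x ∷ xs) []       z∈ = inj₁ z∈
∈-symDiff⁻ (x ∷ xs) (y ∷ ys) {z} = symDiff-∷-elim (λ l → z ∈ l → z ∈ x ∷ xs ⊎ z ∈ y ∷ ys) x y xs ys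
  (λ _ z∈ → Sum.[ inj₁ ∘ here , Sum.map₁ there ∘ ∈-symDiff⁻ xs (y ∷ ys) ]′ (toSum z∈))
  (λ _ z∈ → Sum.[ inj₂ ∘ here , Sum.map₂ there ∘ ∈-symDiff⁻ (x ∷ xs) ys ]′ (toSum z∈))
  (λ _ z∈ → Sum.map there there (∈-symDiff⁻ xs ys z∈))

Disjoint : List ℕ → List ℕ → Set
Disjoint xs ys = ∀ {z} → z ∈ xs → z ∈ ys → ⊥

length-symDiff : ∀ xs ys → Disjoint xs ys → length (symDiff xs ys) ≡ length xs + length ys
length-symDiff []       ys       _    = refl
length-symDiff (x ∷ xs) []       _    = sym (+-identityʳ _)
length-symDiff (x ∷ xs) (y ∷ ys) disj = symDiff-∷-elim (λ l → length l ≡ length (x ∷ xs) + length (y ∷ ys)) x y xs ys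
  (λ _ → cong suc (length-symDiff xs (y ∷ ys) (disj ∘ there)))
  (λ _ → trans (cong suc (length-symDiff (x ∷ xs) ys λ p q → disj p (there q))) (sym (+-suc (length (x ∷ xs)) (length ys))))
  (λ { refl → contradiction (here refl) (λ x∈ → disj x∈ (here refl)) })

-- r s² = r' t² is impossible for suitable r ≠ r'

Separated : ℕ → ℕ → Set
Separated r r' = ∀ s t → 0 < s → 0 < t → r * (s * s) ≢ r' * (t * t)

separated-sym : ∀ {r r'} → Separated r r' → Separated r' r
separated-sym sep s t 0<s 0<t eq = sep t s 0<t 0<s (sym eq)

module _ {p : ℕ} (pp : Prime p) where
  private instance
    p≢0 : NonZero p
    p≢0 = prime⇒nonZero pp

  ∣-square : ∀ x → p ∣ x * x → p ∣ x
  ∣-square x p∣x² with euclidsLemma x x pp p∣x²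
  ... | inj₁ p∣x = p∣x
  ... | inj₂ p∣x = p∣x

  ∣-cancelˡ : ∀ {a b} → ¬ p ∣ a → p ∣ a * b → p ∣ b
  ∣-cancelˡ {a} {b} p∤a p∣ab with euclidsLemma a b pp p∣ab
  ... | inj₁ p∣a = contradiction p∣a p∤a
  ... | inj₂ p∣b = p∣b

  -- Divide p out of t, then out of s, to get a smaller solution.
  p*u*s²≢y*t² : ∀ {u y} → ¬ p ∣ u → ¬ p ∣ y → ∀ s t → 0 < s → p * u * (s * s) ≢ y * (t * t)
  p*u*s²≢y*t² {u} {y} p∤u p∤y = <-rec _ descend
    where
    open ≡-Reasoning

    y*t²≡u*s²*p : ∀ s t → p * u * (s * s) ≡ y * (t * t) → y * (t * t) ≡ u * (s * s) * p
    y*t²≡u*s²*p s t eq = trans (sym eq) (trans (*-assoc p u (s * s)) (*-comm p (u * (s * s))))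

    cancel-t : ∀ s t₁ → p * u * (s * s) ≡ y * ((t₁ * p) * (t₁ * p)) → u * (s * s) ≡ y * (t₁ * t₁) * p
    cancel-t s t₁ eq = *-cancelˡ-≡ _ _ p (begin
      p * (u * (s * s))          ≡⟨ *-assoc p u (s * s) ⟨
      p * u * (s * s)            ≡⟨ eq ⟩
      y * ((t₁ * p) * (t₁ * p))  ≡⟨ pull-p y t₁ p ⟩
      p * (y * (t₁ * t₁) * p)    ∎)
      where
      pull-p : ∀ y t q → y * ((t * q) * (t * q)) ≡ q * (y * (t * t) * q)
      pull-p = solve-∀

    cancel-s : ∀ s₁ t₁ → p * u * ((s₁ * p) * (s₁ * p)) ≡ y * ((t₁ * p) * (t₁ * p)) → p * u * (s₁ * s₁) ≡ y * (t₁ * t₁)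
    cancel-s s₁ t₁ eq = *-cancelˡ-≡ _ _ (p * p) {{m*n≢0 p p}} (begin
      p * p * (p * u * (s₁ * s₁))    ≡⟨ pull-p² (p * u) s₁ p ⟩
      p * u * ((s₁ * p) * (s₁ * p))  ≡⟨ eq ⟩
      y * ((t₁ * p) * (t₁ * p))      ≡⟨ pull-p² y t₁ p ⟨
      p * p * (y * (t₁ * t₁))        ∎)
      where
      pull-p² : ∀ x s q → q * q * (x * (s * s)) ≡ x * ((s * q) * (s * q))
      pull-p² = solve-∀

    descend : ∀ s → (∀ {s₁} → s₁ < s → ∀ t → 0 < s₁ → p * u * (s₁ * s₁) ≢ y * (t * t)) →
              ∀ t → 0 < s → p * u * (s * s) ≢ y * (t * t)
    descend s rec t 0<s eq with ∣-square t (∣-cancelˡ p∤y (divides (u * (s * s)) (y*t²≡u*s²*p s t eq)))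
    ... | divides t₁ refl with ∣-square s (∣-cancelˡ p∤u (divides (y * (t₁ * t₁)) (cancel-t s t₁ eq)))
    ...   | divides s₁ refl = rec s₁<s t₁ 0<s₁ (cancel-s s₁ t₁ eq)
      where
      0<s₁ : 0 < s₁
      0<s₁ = >-nonZero⁻¹ s₁ {{m*n≢0⇒m≢0 s₁ {{>-nonZero 0<s}}}}
      s₁<s : s₁ < s₁ * p
      s₁<s = m<m*n s₁ p {{>-nonZero 0<s₁}} (nonTrivial⇒n>1 p {{prime⇒nonTrivial pp}})

Separates : ℕ → ℕ → ℕ → Set
Separates p r r' = Prime p × p ∣ r × ¬ (p * p ∣ r) × ¬ (p ∣ r')

separates? : ∀ p r r' → Dec (Separates p r r')
separates? p r r' = prime? p ×-dec p ∣? r ×-dec ¬? (p * p ∣? r) ×-dec ¬? (p ∣? r')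

separates⇒separated : ∀ {p r r'} → Separates p r r' → Separated r r'
separates⇒separated {p} {r} {r'} (pp , divides u refl , p²∤r , p∤r') s t 0<s _ eq =
  p*u*s²≢y*t² pp p∤u p∤r' s t 0<s (trans (cong (_* (s * s)) (*-comm p u)) eq)
  where
  p∤u : ¬ p ∣ u
  p∤u (divides q refl) = p²∤r (divides q (*-assoc q p p))

-- The bound only serves to make the search for p decidable.
Separable : ℕ → ℕ → Set
Separable r r' = ∃ λ p → p < suc (r + r') × (Separates p r r' ⊎ Separates p r' r)

separable? : ∀ r r' → Dec (Separable r r')
separable? r r' = anyUpTo? (λ p → separates? p r r' ⊎-dec separates? p r' r) (suc (r + r'))

separable⇒separated : ∀ {r r'} → Separable r r' → Separated r r'
separable⇒separated {r} {r'} (p , _ , inj₁ split) = separates⇒separated {p} {r} {r'} split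
separable⇒separated {r} {r'} (p , _ , inj₂ split) = separated-sym {r'} {r} (separates⇒separated {p} {r'} {r} split)

-- Sums of scaled squares with disjoint supports

infix 8 _·²_
_·²_ : ℕ → List ℕ → List ℕ
r ·² K = scale r (map square K)

Σ·² : List (ℕ × List ℕ) → List ℕ
Σ·² []             = []
Σ·² ((r , K) ∷ ps) = r ·² K ++ Σ·² ps

·²-⊗ : ∀ r K P → r ·² (K ⊗ P) ≡ r ·² K ⊗ map square P
·²-⊗ r K P = trans (cong (scale r) (sq-⊗ K P)) (sym (map-*-⊗ r (map square K) (map square P)))

∈-·²⁻ : ∀ {r Y z} → Positive Y → z ∈ r ·² Y → ∃ λ s → 0 < s × z ≡ r * square s
∈-·²⁻ {r} pY z∈ with ∈-map⁻ (r *_) z∈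
... | _ , y²∈ , refl with ∈-map⁻ square y²∈
...   | s , s∈ , refl = s , All.lookup pY s∈ , refl

AdmissiblePiece : ℕ × List ℕ → Set
AdmissiblePiece (r , K) = 0 < r × Strict K × Positive K

Admissible : List (ℕ × List ℕ) → Set
Admissible ps = All AdmissiblePiece ps × AllPairs Separable (map proj₁ ps)

admissible? : ∀ ps → Dec (Admissible ps)
admissible? ps = all? (λ (r , K) → 0 <? r ×-dec strict? K ×-dec all? (0 <?_) K) ps
  ×-dec allPairs? separable? (map proj₁ ps)

module _ {P : List ℕ} (sP : Strict P) (pP : Positive P) where

  merge : List (ℕ × List ℕ) → List ℕ
  merge []             = []
  merge ((r , K) ∷ ps) = symDiff (r ·² nabla P K) (merge ps)

  merge~ : ∀ ps → merge ps ~ Σ·² ps ⊗ map square P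
  merge~ []             = ~-refl
  merge~ ((r , K) ∷ ps) = begin
    symDiff (r ·² nabla P K) (merge ps)          ≈⟨ symDiff~++ (r ·² nabla P K) (merge ps) ⟩
    r ·² nabla P K ++ merge ps                   ≈⟨ ++⁺ (map⁺ (r *_) (map⁺ square (~-trans (nabla~⊗ P K) (⊗-comm P K)))) (merge~ ps) ⟩
    r ·² (K ⊗ P) ++ Σ·² ps ⊗ map square P        ≡⟨ cong (_++ Σ·² ps ⊗ map square P) (·²-⊗ r K P) ⟩
    r ·² K ⊗ map square P ++ Σ·² ps ⊗ map square P ≡⟨ ⊗-distribʳ-++ (r ·² K) (Σ·² ps) (map square P) ⟨
    Σ·² ((r , K) ∷ ps) ⊗ map square P            ∎
    where open ~-Reasoning

  merge-strict : ∀ ps → All AdmissiblePiece ps → Strict (merge ps)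
  merge-strict []             []                       = []
  merge-strict ((r , K) ∷ ps) ((0<r , sK , _) ∷ good) =
    symDiff-strict _ _ (scale-strict 0<r (square-strict (nabla-strict pP sK))) (merge-strict ps good)

  ∈-merge⁻ : ∀ ps {z} → All AdmissiblePiece ps → z ∈ merge ps →
             ∃ λ r → r ∈ map proj₁ ps × ∃ λ t → 0 < t × z ≡ r * square t
  ∈-merge⁻ ((r , K) ∷ ps) ((_ , _ , pK) ∷ good) z∈ with ∈-symDiff⁻ (r ·² nabla P K) (merge ps) z∈
  ... | inj₁ z∈piece = r , here refl , ∈-·²⁻ {r} (nabla-positive pP pK) z∈piece
  ... | inj₂ z∈rest with ∈-merge⁻ ps good z∈rest
  ...   | r' , r'∈ , rest = r' , there r'∈ , rest

  length-merge : ∀ ps → Admissible ps → length (merge ps) ≡ sum (map (length ∘ nabla P ∘ proj₂) ps)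
  length-merge []             _ = refl
  length-merge ((r , K) ∷ ps) (((_ , _ , pK) ∷ goods) , r-sep ∷ seps) = begin
    length (symDiff (r ·² nabla P K) (merge ps))     ≡⟨ length-symDiff (r ·² nabla P K) (merge ps) disjoint ⟩
    length (r ·² nabla P K) + length (merge ps)      ≡⟨ cong₂ _+_ length-·² (length-merge ps (goods , seps)) ⟩
    length (nabla P K) + sum (map (length ∘ nabla P ∘ proj₂) ps) ∎
    where
    open ≡-Reasoning
    length-·² : length (r ·² nabla P K) ≡ length (nabla P K)
    length-·² = trans (length-map (r *_) (map square (nabla P K))) (length-map square (nabla P K))
    disjoint : Disjoint (r ·² nabla P K) (merge ps)
    disjoint z∈piece z∈rest with ∈-·²⁻ {r} (nabla-positive pP pK) z∈piece | ∈-merge⁻ ps goods z∈rest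
    ... | s , 0<s , z≡rs² | r' , r'∈ , t , 0<t , z≡r't² =
      separable⇒separated (All.lookup r-sep r'∈) s t 0<s 0<t (trans (sym z≡rs²) z≡r't²)

  length-by-pieces : ∀ {T L} ps → Strict T → Admissible ps → T ~ L ⊗ map square P → L ~ Σ·² ps →
                     length T ≡ sum (map (length ∘ nabla P ∘ proj₂) ps)
  length-by-pieces {T} ps sT good@(goods , _) T~ L~ = trans (cong length T≡merge) (length-merge ps good)
    where
    T≡merge : T ≡ merge ps
    T≡merge = strict-~⇒≡ sT (merge-strict ps goods)
      (~-trans T~ (~-trans (⊗-congˡ (map square P) L~) (~-sym (merge~ ps))))

H8pow-positive : ∀ k → Positive (H8pow k)
H8pow-positive zero    = z<s ∷ []
H8pow-positive (suc k) = nabla-positive (H8pow-positive k) (from-yes (all? (0 <?_) H8))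

H8pow-strict : ∀ k → Strict (H8pow k)
H8pow-strict zero    = [] ∷ []
H8pow-strict (suc k) = nabla-strict (H8pow-positive k) (from-yes (strict? H8))

H8pow-+ : ∀ a b → H8pow (a + b) ~ H8pow a ⊗ H8pow b
H8pow-+ a zero    rewrite +-identityʳ a = ~-sym (⊗-identityʳ (H8pow a))
H8pow-+ a (suc b) rewrite +-suc a b = begin
  nabla (H8pow (a + b)) H8          ≈⟨ nabla~⊗ (H8pow (a + b)) H8 ⟩
  H8pow (a + b) ⊗ H8                ≈⟨ ⊗-congˡ H8 (H8pow-+ a b) ⟩
  H8pow a ⊗ H8pow b ⊗ H8            ≡⟨ ⊗-assoc (H8pow a) (H8pow b) H8 ⟩
  H8pow a ⊗ (H8pow b ⊗ H8)          ≈⟨ ⊗-congʳ (H8pow a) (nabla~⊗ (H8pow b) H8) ⟨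
  H8pow a ⊗ nabla (H8pow b) H8      ∎
  where open ~-Reasoning

nabla-H8pow-split : ∀ e k K → nabla (H8pow (e + (k + k))) K ~ H8pow e ⊗ K ⊗ map square (H8pow k)
nabla-H8pow-split e k K = begin
  nabla (H8pow (e + (k + k))) K       ≈⟨ nabla~⊗ (H8pow (e + (k + k))) K ⟩
  H8pow (e + (k + k)) ⊗ K             ≈⟨ ⊗-congˡ K (H8pow-+ e (k + k)) ⟩
  H8pow e ⊗ H8pow (k + k) ⊗ K         ≈⟨ ⊗-congˡ K (⊗-congʳ (H8pow e) (~-trans (H8pow-+ k k) (⊗-self (H8pow k)))) ⟩
  H8pow e ⊗ Q ⊗ K                     ≡⟨ ⊗-assoc (H8pow e) Q K ⟩
  H8pow e ⊗ (Q ⊗ K)                   ≈⟨ ⊗-congʳ (H8pow e) (⊗-comm Q K) ⟩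
  H8pow e ⊗ (K ⊗ Q)                   ≡⟨ ⊗-assoc (H8pow e) K Q ⟨
  H8pow e ⊗ K ⊗ Q                     ∎
  where
  open ~-Reasoning
  Q : List ℕ
  Q = map square (H8pow k)

K₁ K₂ K₄ : List ℕ
K₁ = 1 ∷ []
K₂ = 1 ∷ 2 ∷ []
K₄ = 1 ∷ 4 ∷ []

count : List ℕ → ℕ → ℕ
count K k = length (nabla (H8pow k) K)

-- The side conditions are decidable, so for explicit e, K and ps they are discharged by evaluation.
count-by-pieces : ∀ e k K ps → {_ : True (strict? K)} → {_ : True (admissible? ps)} →
                  {_ : True (≡-dec _≟_ (normalize (H8pow e ⊗ K)) (normalize (Σ·² ps)))} →
                  count K (e + (k + k)) ≡ sum (map ((λ K′ → count K′ k) ∘ proj₂) ps)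
count-by-pieces e k K ps {sK} {good} {same} =
  length-by-pieces (H8pow-strict k) (H8pow-positive k) {L = H8pow e ⊗ K} ps
    (nabla-strict (H8pow-positive (e + (k + k))) (toWitness sK)) (toWitness good)
    (nabla-H8pow-split e k K) (≡-normalize⇒~ (H8pow e ⊗ K) (Σ·² ps) (toWitness same))

card≡count : ∀ k → card k ≡ count K₁ k
card≡count k = cong length (strict-~⇒≡ (H8pow-strict k) (nabla-strict (H8pow-positive k) ([] ∷ []))
  (~-sym (~-trans (nabla~⊗ (H8pow k) K₁) (⊗-identityʳ (H8pow k)))))

data Counts : Set where
  ⟨_,_,_⟩ : ℕ → ℕ → ℕ → Counts

⟨⟩-cong : ∀ {a a′ b b′ c c′} → a ≡ a′ → b ≡ b′ → c ≡ c′ → ⟨ a , b , c ⟩ ≡ ⟨ a′ , b′ , c′ ⟩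
⟨⟩-cong refl refl refl = refl

counts : ℕ → Counts
counts k = ⟨ count K₁ k , count K₂ k , count K₄ k ⟩

evenStep : Counts → Counts
evenStep ⟨ a , b , c ⟩ = ⟨ a , 2 * a , b ⟩

oddStep : Counts → Counts
oddStep ⟨ a , b , c ⟩ = ⟨ 4 * a + 2 * b , 4 * a + b + c , 4 * b + 2 * c ⟩

evenStep-sums : ∀ a b c → ⟨ a + 0 , a + (a + 0) , b + 0 ⟩ ≡ evenStep ⟨ a , b , c ⟩
evenStep-sums a b c = ⟨⟩-cong (+-identityʳ a) refl (+-identityʳ b)

oddStep-sums : ∀ a b c →
  ⟨ b + (b + (a + (a + (a + (a + 0))))) , c + (b + (a + (a + (a + (a + 0))))) , c + (c + (b + (b + (b + (b + 0))))) ⟩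
  ≡ oddStep ⟨ a , b , c ⟩
oddStep-sums a b c = ⟨⟩-cong (solve (a ∷ₗ b ∷ₗ []ₗ)) (solve (a ∷ₗ b ∷ₗ c ∷ₗ []ₗ)) (solve (b ∷ₗ c ∷ₗ []ₗ))

counts-double : ∀ k → counts (k + k) ≡ evenStep (counts k)
counts-double k = trans (⟨⟩-cong
  (count-by-pieces 0 k K₁ ((1 , K₁) ∷ []))
  (count-by-pieces 0 k K₂ ((1 , K₁) ∷ (2 , K₁) ∷ []))
  (count-by-pieces 0 k K₄ ((1 , K₂) ∷ [])))
  (evenStep-sums (count K₁ k) (count K₂ k) (count K₄ k))

-- H₈ = K₂² + x₂K₂² + x₃ + x₅ + x₆ + x₇, H₈K₂ = K₄² + x₃K₂² + x₅ + x₇ + x₁₀ + x₁₄ and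
-- H₈K₄ = K₄² + x₂K₄² + x₃K₂² + x₅K₂² + x₆K₂² + x₇K₂² in 𝔽₂[(ℕ, ·)], where Kᵢ = 1 + xᵢ.
counts-double+1 : ∀ k → counts (1 + (k + k)) ≡ oddStep (counts k)
counts-double+1 k = trans (⟨⟩-cong
  (count-by-pieces 1 k K₁ ((1 , K₂) ∷ (2 , K₂) ∷ (3 , K₁) ∷ (5 , K₁) ∷ (6 , K₁) ∷ (7 , K₁) ∷ []))
  (count-by-pieces 1 k K₂ ((1 , K₄) ∷ (3 , K₂) ∷ (5 , K₁) ∷ (7 , K₁) ∷ (10 , K₁) ∷ (14 , K₁) ∷ []))
  (count-by-pieces 1 k K₄ ((1 , K₄) ∷ (2 , K₄) ∷ (3 , K₂) ∷ (5 , K₂) ∷ (6 , K₂) ∷ (7 , K₂) ∷ [])))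
  (oddStep-sums (count K₁ k) (count K₂ k) (count K₄ k))

after011 : Counts → Counts
after011 x = oddStep (oddStep (evenStep x))

after011-closed : ∀ a b c → after011 ⟨ a , b , c ⟩ ≡ ⟨ 44 * a + 2 * b , 46 * a + 3 * b , 40 * a + 8 * b ⟩
after011-closed a b c = ⟨⟩-cong (solve (a ∷ₗ b ∷ₗ []ₗ)) (solve (a ∷ₗ b ∷ₗ []ₗ)) (solve (a ∷ₗ b ∷ₗ []ₗ))

counts-8*k+3 : ∀ k → counts (8 * k + 3) ≡ after011 (counts k)
counts-8*k+3 k = begin
  counts (8 * k + 3)                  ≡⟨ cong counts (binary k) ⟩
  counts (1 + (k₁ + k₁))              ≡⟨ counts-double+1 k₁ ⟩
  oddStep (counts k₁)                 ≡⟨ cong oddStep (counts-double+1 (k + k)) ⟩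
  oddStep (oddStep (counts (k + k)))  ≡⟨ cong (oddStep ∘ oddStep) (counts-double k) ⟩
  after011 (counts k)                 ∎
  where
  open ≡-Reasoning
  k₁ : ℕ
  k₁ = 1 + ((k + k) + (k + k))
  binary : ∀ k → 8 * k + 3 ≡ 1 + ((1 + ((k + k) + (k + k))) + (1 + ((k + k) + (k + k))))
  binary = solve-∀

first : Counts → ℕ
first ⟨ a , _ , _ ⟩ = a

after011²-identity : ∀ a b c → first (after011 (after011 ⟨ a , b , c ⟩)) + 40 * a ≡ 47 * first (after011 ⟨ a , b , c ⟩)
after011²-identity a b c = begin
  first (after011 (after011 ⟨ a , b , c ⟩)) + 40 * a    ≡⟨ cong (λ x → first (after011 x) + 40 * a) (after011-closed a b c) ⟩
  first (after011 ⟨ a′ , b′ , c′ ⟩) + 40 * a            ≡⟨ cong (λ x → first x + 40 * a) (after011-closed a′ b′ c′) ⟩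
  44 * a′ + 2 * b′ + 40 * a                             ≡⟨ linear a b ⟩
  47 * a′                                               ≡⟨ cong (λ x → 47 * first x) (after011-closed a b c) ⟨
  47 * first (after011 ⟨ a , b , c ⟩)                   ∎
  where
  open ≡-Reasoning
  a′ b′ c′ : ℕ
  a′ = 44 * a + 2 * b
  b′ = 46 * a + 3 * b
  c′ = 40 * a + 8 * b
  linear : ∀ a b → 44 * (44 * a + 2 * b) + 2 * (46 * a + 3 * b) + 40 * a ≡ 47 * (44 * a + 2 * b)
  linear = solve-∀

card-identity : ∀ m → card (64 * m + 27) + 40 * card m ≡ 47 * card (8 * m + 3)
card-identity m = begin
  card (64 * m + 27) + 40 * card m                 ≡⟨ cong₂ (λ x y → x + 40 * y) (card≡count (64 * m + 27)) (card≡count m) ⟩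
  first (counts (64 * m + 27)) + 40 * a            ≡⟨ cong (λ n → first (counts n) + 40 * a) (digits m) ⟩
  first (counts (8 * (8 * m + 3) + 3)) + 40 * a    ≡⟨ cong (λ x → first x + 40 * a) (counts-8*k+3 (8 * m + 3)) ⟩
  first (after011 (counts (8 * m + 3))) + 40 * a   ≡⟨ cong (λ x → first (after011 x) + 40 * a) (counts-8*k+3 m) ⟩
  first (after011 (after011 (counts m))) + 40 * a  ≡⟨ after011²-identity (count K₁ m) (count K₂ m) (count K₄ m) ⟩
  47 * first (after011 (counts m))                 ≡⟨ cong (λ x → 47 * first x) (counts-8*k+3 m) ⟨
  47 * first (counts (8 * m + 3))                  ≡⟨ cong (47 *_) (card≡count (8 * m + 3)) ⟨
  47 * card (8 * m + 3)                            ∎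
  where
  open ≡-Reasoning
  a : ℕ
  a = first (counts m)
  digits : ∀ m → 64 * m + 27 ≡ 8 * (8 * m + 3) + 3
  digits = solve-∀

m+k≡n⇒+m≡+n-+k : ∀ {m n k} → m + k ≡ n → + m ≡ + n - + k
m+k≡n⇒+m≡+n-+k {m} {n} {k} m+k≡n = begin
  + m            ≡⟨ cong +_ (m+n∸n≡m m k) ⟨
  + (m + k ∸ k)  ≡⟨ cong (λ x → + (x ∸ k)) m+k≡n ⟩
  + (n ∸ k)      ≡⟨ ℤ.⊖-≥ (subst (k ≤_) m+k≡n (m≤n+m k m)) ⟨
  n ⊖ k          ≡⟨ ℤ.[+m]-[+n]≡m⊖n n k ⟨
  + n - + k      ∎
  where open ≡-Reasoning

-- The identity also holds for m = 0.
lemma16 : (m : ℕ) → 1 ≤ m →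
    + card (64 Data.Nat.* m Data.Nat.+ 27) ≡
      (+ 47) Data.Integer.* (+ card (8 Data.Nat.* m Data.Nat.+ 3)) - (+ 40) Data.Integer.* (+ card m)
lemma16 m _ = trans (m+k≡n⇒+m≡+n-+k (card-identity m))
  (cong₂ _-_ (ℤ.pos-* 47 (card (8 * m + 3))) (ℤ.pos-* 40 (card m)))
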